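{- Whenever $u \sqsubseteq v$ and $v'$ is obtainable from $v$ by some $\langle \mathtt{transf}, f\rangle$ with distributive $f$, there exists $u'$ obtainable from $u$ by $\langle \mathtt{transf}, f\rangle$ and such that $u' \sqsubseteq v'$.
   Context: Let $C \subseteq \mathcal{P}(X)\setminus\{\emptyset\}$ be a set of counters over a finite basis $X$, and counter valuations be maps $C \to \mathbb{N}$, ordered pointwise by $\leq$. A mapping $f: C \to \mathcal{P}(C)$ is distributive if whenever $c \in C$, $c \subseteq \bigcup_{i=1}^k c_i$ and $c'_i \in f(c_i)$ for each $i$, there exists $c' \in f(c)$ with $c' \subseteq \bigcup_{i=1}^k c'_i$. A valuation $v'$ is obtainable from $v$ by $\langle \mathtt{transf}, f\rangle$ iff there exist $K^c_{c'} \geq 0$ ($c \in C$, $c' \in f(c)$) with $v(c) = \sum_{c' \in f(c)} K^c_{c'}$ for each $c$ and $v'(c') = \sum_{f(c) \ni c'} K^c_{c'}$ for each $c'$. For valuations $u$ and $v$, $u \sqsubseteq v$ iff there exists $v_\dag \leq v$ obtainable from $u$ by $\langle \mathtt{transf}, c \mapsto \{d \in C : c \subseteq d\}\rangle$. -}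

module Defs where

open import Data.Nat using (ℕ; _≤_)
open import Data.Fin using (Fin)
open import Data.Fin.Subset using (Subset; _∈_; _⊆_; Nonempty)
open import Data.Bool using (Bool; true; false; T)
open import Data.Product using (Σ; ∃; _×_; _,_)
open import Relation.Binary.PropositionalEquality using (_≡_)
open import Function.Definitions using (Injective)
open import Data.Vec.Functional using (foldr)
open import Data.Nat using (_+_)
open import Relation.Nullary using (¬_)

sumF : ∀ {m} → (Fin m → ℕ) → ℕ
sumF g = foldr _+_ 0 g

-- A set C of counters over the finite basis X = Fin n:
-- counters are indexed by Fin m, each counter is a nonempty subset of X,
-- and distinct indices give distinct subsets (C is a set).
record Counters (n m : ℕ) : Set where
  field
    ctr      : Fin m → Subset n
    nonempty : ∀ c → Nonempty (ctr c)
    distinct : Injective _≡_ _≡_ ctr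
open Counters public

Valuation : ℕ → Set
Valuation m = Fin m → ℕ

_≤ᵥ_ : ∀ {m} → Valuation m → Valuation m → Set
u ≤ᵥ v = ∀ c → u c ≤ v c

-- A mapping f : C → P(C), given by its (decidable) membership: c' ∈ f(c) iff T (f c c').
Mapping : ℕ → Set
Mapping m = Fin m → Fin m → Bool

_∈⋃_ : ∀ {n m k} → Fin n → (Fin m → Subset n) × (Fin k → Fin m) → Set
x ∈⋃ (s , cs) = ∃ λ i → x ∈ s (cs i)

_⊆⋃_ : ∀ {n m k} → Subset n → (Fin m → Subset n) × (Fin k → Fin m) → Set
a ⊆⋃ p = ∀ {x} → x ∈ a → x ∈⋃ p

Distributive : ∀ {n m} → Counters n m → Mapping m → Set
Distributive C f =
  ∀ (c : _) (k : ℕ) (cs : Fin k → _) →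
    ctr C c ⊆⋃ (ctr C , cs) →
    (cs' : Fin k → _) → (∀ i → T (f (cs i) (cs' i))) →
    ∃ λ c' → T (f c c') × ctr C c' ⊆⋃ (ctr C , cs')

-- v' is obtainable from v by ⟨transf, f⟩: there are coefficients K c c' ≥ 0
-- for c ∈ C, c' ∈ f(c) (encoded as K c c' = 0 whenever c' ∉ f(c)) with
-- v(c) = Σ_{c' ∈ f(c)} K c c'  and  v'(c') = Σ_{c : c' ∈ f(c)} K c c'.
Obtainable : ∀ {m} → Mapping m → Valuation m → Valuation m → Set
Obtainable {m} f v v' =
  Σ (Fin m → Fin m → ℕ) λ K →
    (∀ c c' → ¬ T (f c c') → K c c' ≡ 0) ×
    (∀ c → v c ≡ sumF (λ c' → K c c')) ×
    (∀ c' → v' c' ≡ sumF (λ c → K c c'))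

upMap : ∀ {n m} → Counters n m → Mapping m
upMap C c d = decToBool (ctr C c ⊆? ctr C d)
  where
  open import Data.Fin.Subset.Properties using (_⊆?_)
  open import Relation.Nullary.Decidable using () renaming (isYes to decToBool)

_⊑[_]_ : ∀ {n m} → Valuation m → Counters n m → Valuation m → Set
u ⊑[ C ] v = ∃ λ v† → v† ≤ᵥ v × Obtainable (upMap C) u v†

module Submission where

open import Defs
open import Data.Nat using (ℕ)
open import Data.Product using (∃; _×_)

-- Let u ⊑ v be witnessed by v† ≤ v and a transfer K₁ : u ⇝ v†
-- along inclusions (K₁ c d > 0 only if c ⊆ d), and let K₂ : v ⇝ v' be a
-- transfer along f.  For each counter d the mass Σ_c K₁ c d = v† d arriving
-- at d is at most the mass v d = Σ_d' K₂ d d' leaving d, so it can be split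
-- into units M c d d' (row sums K₁ c d, column sums ≤ K₂ d d').  A unit
-- travelling c ⊆ d ↦ d' ∈ f(d) is rerouted, by distributivity, to some
-- c' ∈ f(c) with c' ⊆ d'.  Collecting units by (c , c' , d') gives a flow
-- F c c' d' supported on "c' ∈ f(c) and c' ⊆ d'"; its marginals give the
-- middle valuation u' (with u ⇝ u' along f) and the target w ≤ v' (with
-- u' ⇝ w along inclusions), so u' ⊑ v'.

open import Data.Nat using (zero; suc; _+_; _∸_; _⊓_; _≤_; z≤n)
open import Data.Nat.Properties
open import Data.Fin using (Fin) renaming (zero to fzero; suc to fsuc)
open import Data.Fin.Subset using (_⊆_)
open import Data.Fin.Subset.Properties using (_⊆?_)
open import Data.Product using (Σ; _,_; proj₁; proj₂)
open import Data.Sum using (_⊎_; inj₁; inj₂)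
import Data.Sum as Sum
open import Data.Bool using (T)
open import Data.Empty using (⊥-elim)
open import Relation.Nullary using (¬_; yes; no)
open import Relation.Nullary.Decidable using (toWitness; fromWitness; T?)
open import Relation.Binary.PropositionalEquality
open import Function using (_∘_)
open import Algebra.Properties.CommutativeMonoid.Sum +-0-commutativeMonoid
  using (sum-cong-≗; sum-replicate-zero; ∑-distrib-+; ∑-comm)

sumF-mono : ∀ {k} {a b : Fin k → ℕ} → (∀ i → a i ≤ b i) → sumF a ≤ sumF b
sumF-mono {zero}  _   = z≤n
sumF-mono {suc k} a≤b = +-mono-≤ (a≤b fzero) (sumF-mono (a≤b ∘ fsuc))

sumF≡0⇒ : ∀ {k} (a : Fin k → ℕ) → sumF a ≡ 0 → ∀ i → a i ≡ 0
sumF≡0⇒ a Σa≡0 fzero    = m+n≡0⇒m≡0 (a fzero) Σa≡0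
sumF≡0⇒ a Σa≡0 (fsuc i) = sumF≡0⇒ (a ∘ fsuc) (m+n≡0⇒n≡0 (a fzero) Σa≡0) i

sumF-zero : ∀ {k} {a : Fin k → ℕ} → (∀ i → a i ≡ 0) → sumF a ≡ 0
sumF-zero {k} a≡0 = trans (sum-cong-≗ a≡0) (sum-replicate-zero k)

point : ∀ {k} → Fin k → ℕ → Fin k → ℕ
point fzero    x fzero    = x
point fzero    x (fsuc j) = 0
point (fsuc i) x fzero    = 0
point (fsuc i) x (fsuc j) = point i x j

point-sum : ∀ {k} (i : Fin k) x → sumF (point i x) ≡ x
point-sum {suc k} fzero    x = trans (cong (x +_) (sum-replicate-zero k)) (+-identityʳ x)
point-sum         (fsuc i) x = point-sum i x

point-off : ∀ {k} {i j : Fin k} x → ¬ i ≡ j → point i x j ≡ 0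
point-off {i = fzero}  {fzero}  x i≢j = ⊥-elim (i≢j refl)
point-off {i = fzero}  {fsuc j} x i≢j = refl
point-off {i = fsuc i} {fzero}  x i≢j = refl
point-off {i = fsuc i} {fsuc j} x i≢j = point-off x (i≢j ∘ cong fsuc)

-- A quantity that is zero, or can be placed at some index satisfying P, is the
-- total of a distribution supported on P.  This turns a (possibly failing)
-- choice of destination into an honest mass distribution.
concentrate : ∀ {k} {P : Fin k → Set} (x : ℕ) → x ≡ 0 ⊎ Σ (Fin k) P →
  Σ (Fin k → ℕ) λ p → sumF p ≡ x × (∀ j → ¬ P j → p j ≡ 0)
concentrate {k} x (inj₁ x≡0) = (λ _ → 0) , trans (sumF-zero {k} (λ _ → refl)) (sym x≡0) , λ _ _ → refl
concentrate {P = P} x (inj₂ (i , Pi)) =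
  point i x , point-sum i x , λ j ¬Pj → point-off x (λ i≡j → ¬Pj (subst P i≡j Pi))

draw : ∀ {q} (b : Fin q → ℕ) x → x ≤ sumF b →
  Σ (Fin q → ℕ) λ r → (∀ j → r j ≤ b j) × sumF r ≡ x
draw {zero}  b x x≤0  = (λ ()) , (λ ()) , sym (n≤0⇒n≡0 x≤0)
draw {suc q} b x x≤Σb
  with draw (b ∘ fsuc) (x ∸ b fzero) (m≤n+o⇒m∸n≤o x (b fzero) x≤Σb)
... | r , r≤b , Σr = r₀ , r₀≤b , trans (cong (b fzero ⊓ x +_) Σr) (m⊓n+n∸m≡n (b fzero) x)
  where
  r₀ : Fin (suc q) → ℕ
  r₀ fzero    = b fzero ⊓ x
  r₀ (fsuc j) = r j
  r₀≤b : ∀ j → r₀ j ≤ b j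
  r₀≤b fzero    = m⊓n≤m (b fzero) x
  r₀≤b (fsuc j) = r≤b j

couple : ∀ {p q} (a : Fin p → ℕ) (b : Fin q → ℕ) → sumF a ≤ sumF b →
  Σ (Fin p → Fin q → ℕ) λ M → (∀ i → sumF (M i) ≡ a i) × (∀ j → sumF (λ i → M i j) ≤ b j)
couple {zero}  a b _ = (λ ()) , (λ ()) , (λ _ → z≤n)
couple {suc p} a b Σa≤Σb with draw b (a fzero) (≤-trans (m≤m+n (a fzero) _) Σa≤Σb)
... | r , r≤b , Σr≡a₀ with couple (a ∘ fsuc) (λ j → b j ∸ r j) rest-fits
  where
  Σb≡ : sumF (λ j → b j ∸ r j) + a fzero ≡ sumF b
  Σb≡ = begin
    sumF (λ j → b j ∸ r j) + a fzero  ≡⟨ cong (sumF (λ j → b j ∸ r j) +_) Σr≡a₀ ⟨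
    sumF (λ j → b j ∸ r j) + sumF r   ≡⟨ ∑-distrib-+ (λ j → b j ∸ r j) r ⟨
    sumF (λ j → b j ∸ r j + r j)      ≡⟨ sum-cong-≗ (λ j → m∸n+n≡m (r≤b j)) ⟩
    sumF b                            ∎
    where open ≡-Reasoning
  rest-fits : sumF (a ∘ fsuc) ≤ sumF (λ j → b j ∸ r j)
  rest-fits = +-cancelʳ-≤ (a fzero) _ _
    (subst (sumF (a ∘ fsuc) + a fzero ≤_) (sym Σb≡)
      (subst (_≤ sumF b) (+-comm (a fzero) _) Σa≤Σb))
... | M , rows , cols = M₀ , rows₀ , cols₀
  where
  M₀ : Fin (suc p) → Fin _ → ℕ
  M₀ fzero    = r
  M₀ (fsuc i) = M i
  rows₀ : ∀ i → sumF (M₀ i) ≡ a i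
  rows₀ fzero    = Σr≡a₀
  rows₀ (fsuc i) = rows i
  cols₀ : ∀ j → sumF (λ i → M₀ i j) ≤ b j
  cols₀ j = ≤-trans (+-monoʳ-≤ (r j) (cols j)) (≤-reflexive (m+[n∸m]≡n (r≤b j)))

upMap⇒⊆ : ∀ {n m} (C : Counters n m) {c d} → T (upMap C c d) → ctr C c ⊆ ctr C d
upMap⇒⊆ C {c} {d} = toWitness {a? = ctr C c ⊆? ctr C d}

⊆⇒upMap : ∀ {n m} (C : Counters n m) {c d} → ctr C c ⊆ ctr C d → T (upMap C c d)
⊆⇒upMap C {c} {d} = fromWitness {a? = ctr C c ⊆? ctr C d}

-- Distributivity for a single covering counter: if c ⊆ d and d' ∈ f(d), then
-- some c' ∈ f(c) satisfies c' ⊆ d'.  This is what lets units be rerouted.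
distributive-⊆ : ∀ {n m} (C : Counters n m) {f : Mapping m} → Distributive C f →
  ∀ {c d d'} → ctr C c ⊆ ctr C d → T (f d d') →
  Σ (Fin m) λ c' → T (f c c') × ctr C c' ⊆ ctr C d'
distributive-⊆ C dist {c} {d} {d'} c⊆d d'∈fd
  with dist c 1 (λ _ → d) (λ x∈c → fzero , c⊆d x∈c) (λ _ → d') (λ _ → d'∈fd)
... | c' , c'∈fc , c'⊆⋃ = c' , c'∈fc , proj₂ ∘ c'⊆⋃

module TwoStepFlow {m} (g h : Mapping m) (F : Fin m → Fin m → Fin m → ℕ)
  (F-supp : ∀ a b c → ¬ (T (g a b) × T (h b c)) → F a b c ≡ 0) where

  middle : Valuation m
  middle b = sumF λ a → sumF λ c → F a b c

  target : Valuation m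
  target c = sumF λ b → sumF λ a → F a b c

  first-step : ∀ {s : Valuation m} → (∀ a → s a ≡ sumF λ b → sumF λ c → F a b c) →
    Obtainable g s middle
  first-step s≡ = (λ a b → sumF (F a b)) , supp , s≡ , λ _ → refl
    where
    supp : ∀ a b → ¬ T (g a b) → sumF (F a b) ≡ 0
    supp a b b∉ga = sumF-zero (λ c → F-supp a b c (b∉ga ∘ proj₁))

  second-step : Obtainable h middle target
  second-step = (λ b c → sumF λ a → F a b c) , supp , (λ b → ∑-comm (λ a c → F a b c)) , λ _ → refl
    where
    supp : ∀ b c → ¬ T (h b c) → sumF (λ a → F a b c) ≡ 0
    supp b c c∉hb = sumF-zero (λ a → F-supp a b c (c∉hb ∘ proj₂))

module Rerouting {n m} (C : Counters n m) {f : Mapping m} (dist : Distributive C f)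
  {u v v' v† : Valuation m} (v†≤v : v† ≤ᵥ v)
  (K₁ : Fin m → Fin m → ℕ) (K₁-supp : ∀ c d → ¬ T (upMap C c d) → K₁ c d ≡ 0)
  (K₁-row : ∀ c → u c ≡ sumF (K₁ c)) (K₁-col : ∀ d → v† d ≡ sumF (λ c → K₁ c d))
  (K₂ : Fin m → Fin m → ℕ) (K₂-supp : ∀ d d' → ¬ T (f d d') → K₂ d d' ≡ 0)
  (K₂-row : ∀ d → v d ≡ sumF (K₂ d)) (K₂-col : ∀ d' → v' d' ≡ sumF (λ d → K₂ d d'))
  where

  -- At each d the incoming mass v† d fits into the outgoing mass v d, so it
  -- splits into units M c d d' travelling c ↦ d ↦ d'.
  coupling : ∀ d → Σ (Fin m → Fin m → ℕ) λ N →
    (∀ c → sumF (N c) ≡ K₁ c d) × (∀ d' → sumF (λ c → N c d') ≤ K₂ d d')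
  coupling d = couple (λ c → K₁ c d) (K₂ d) (subst₂ _≤_ (K₁-col d) (K₂-row d) (v†≤v d))

  M : Fin m → Fin m → Fin m → ℕ
  M c d = proj₁ (coupling d) c

  M-row : ∀ c d → sumF (M c d) ≡ K₁ c d
  M-row c d = proj₁ (proj₂ (coupling d)) c

  M-col : ∀ d d' → sumF (λ c → M c d d') ≤ K₂ d d'
  M-col d = proj₂ (proj₂ (coupling d))

  M-supp : ∀ c d d' → M c d d' ≡ 0 ⊎ (ctr C c ⊆ ctr C d × T (f d d'))
  M-supp c d d' with T? (upMap C c d) | T? (f d d')
  ... | yes c↑d | yes d'∈fd = inj₂ (upMap⇒⊆ C c↑d , d'∈fd)
  ... | no ¬c↑d | _         = inj₁ (sumF≡0⇒ (M c d) (trans (M-row c d) (K₁-supp c d ¬c↑d)) d')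
  ... | yes _   | no d'∉fd  = inj₁ (sumF≡0⇒ (λ c → M c d d')
    (n≤0⇒n≡0 (subst (sumF (λ c → M c d d') ≤_) (K₂-supp d d' d'∉fd) (M-col d d'))) c)

  Rerouted : Fin m → Fin m → Fin m → Set
  Rerouted c d' c' = T (f c c') × ctr C c' ⊆ ctr C d'

  reroute : ∀ c d d' → Σ (Fin m → ℕ) λ p →
    sumF p ≡ M c d d' × (∀ c' → ¬ Rerouted c d' c' → p c' ≡ 0)
  reroute c d d' = concentrate (M c d d')
    (Sum.map₂ (λ (c⊆d , d'∈fd) → distributive-⊆ C dist c⊆d d'∈fd) (M-supp c d d'))

  flow : Fin m → Fin m → Fin m → ℕ
  flow c c' d' = sumF λ d → proj₁ (reroute c d d') c'

  flow-supp : ∀ c c' d' → ¬ (T (f c c') × T (upMap C c' d')) → flow c c' d' ≡ 0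
  flow-supp c c' d' ¬step = sumF-zero λ d →
    proj₂ (proj₂ (reroute c d d')) c' λ (c'∈fc , c'⊆d') → ¬step (c'∈fc , ⊆⇒upMap C c'⊆d')

  flow-out : ∀ c d' → sumF (λ c' → flow c c' d') ≡ sumF (λ d → M c d d')
  flow-out c d' = trans (∑-comm (λ c' d → proj₁ (reroute c d d') c'))
    (sum-cong-≗ λ d → proj₁ (proj₂ (reroute c d d')))

  open TwoStepFlow f (upMap C) flow flow-supp public

  source-u : ∀ c → u c ≡ sumF λ c' → sumF λ d' → flow c c' d'
  source-u c = begin
    u c                                                  ≡⟨ K₁-row c ⟩
    sumF (K₁ c)                                          ≡⟨ sum-cong-≗ (λ d → M-row c d) ⟨
    sumF (λ d → sumF λ d' → M c d d')                    ≡⟨ ∑-comm (M c) ⟩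
    sumF (λ d' → sumF λ d → M c d d')                    ≡⟨ sum-cong-≗ (flow-out c) ⟨
    sumF (λ d' → sumF λ c' → flow c c' d')               ≡⟨ ∑-comm (λ d' c' → flow c c' d') ⟩
    sumF (λ c' → sumF λ d' → flow c c' d')               ∎
    where open ≡-Reasoning

  target≤v' : target ≤ᵥ v'
  target≤v' d' = begin
    sumF (λ c' → sumF λ c → flow c c' d')  ≡⟨ ∑-comm (λ c' c → flow c c' d') ⟩
    sumF (λ c → sumF λ c' → flow c c' d')  ≡⟨ sum-cong-≗ (λ c → flow-out c d') ⟩
    sumF (λ c → sumF λ d → M c d d')       ≡⟨ ∑-comm (λ c d → M c d d') ⟩
    sumF (λ d → sumF λ c → M c d d')       ≤⟨ sumF-mono (λ d → M-col d d') ⟩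
    sumF (λ d → K₂ d d')                   ≡⟨ K₂-col d' ⟨
    v' d'                                  ∎
    where open ≤-Reasoning

lemma3p1 : ∀ {n m} (C : Counters n m) (f : Mapping m) → Distributive C f →
    (u v v' : Valuation m) → u ⊑[ C ] v → Obtainable f v v' →
    ∃ λ u' → Obtainable f u u' × u' ⊑[ C ] v'
lemma3p1 C f dist u v v' (v† , v†≤v , K₁ , K₁-supp , K₁-row , K₁-col) (K₂ , K₂-supp , K₂-row , K₂-col) =
  middle , first-step source-u , target , target≤v' , second-step
  where
  open Rerouting C dist v†≤v K₁ K₁-supp K₁-row K₁-col K₂ K₂-supp K₂-row K₂-col
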